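{- If $n$ is a non-negative integer, then \[ \sum_{k = 1}^n \sum_{j = 0}^{k - 1} \frac{\binom{n}{j}^2}{k - j} = \binom{2n}{n} \left(2H_n - H_{2n} \right) \] and \[ \sum_{k = 1}^n \sum_{j = 0}^{k - 1} \frac{1}{k - j}\binom{n}{j}\binom{2n}{n + j} = \binom{3n}{n} H_n - \sum_{k = 1}^n \frac{1}{k}\binom{3n - k}{n - k}. \]
   Context: $H_n=\sum_{m=1}^n\frac1m$. Empty sums are $0$. -}

module Defs where

open import Data.Nat using (ℕ; zero; suc; _∸_)
open import Data.Integer using (+_)
open import Data.Rational using (ℚ; 0ℚ; _+_; _/_)

sumBelow : ℕ → (ℕ → ℚ) → ℚ
sumBelow zero    f = 0ℚ
sumBelow (suc n) f = sumBelow n f + f n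

sum1to : ℕ → (ℕ → ℚ) → ℚ
sum1to n f = sumBelow n (λ i → f (suc i))

frac : ℕ → ℕ → ℚ
frac a d = (+ a) / suc d

H : ℕ → ℚ
H n = sumBelow n (λ i → frac 1 i)

{-# OPTIONS --safe #-}
-- Both double sums are Cauchy products with the harmonic numbers,
-- Σ_{k ≤ n} Σ_{j < k} a_j / (k - j) = Σ_{j ≤ n} a_j H_{n-j}. After reversing j = n - i the
-- coefficients become C(n,i) C(c,i), with c = n resp. c = 2n, and we split H_i = H_n - (H_n - H_i).
-- Both B(m,r) = C(m+r,m) and E(m,r) = B(m,r) (H_{m+r} - H_r) satisfy Pascal's recurrence in (m,r)
-- and are constant on m = 0, and every such family G satisfies the Vandermonde convolution
-- Σ_i C(c,i) G(n-i, r+i) = G(n, r+c). As E(n-i, i) = C(n,i) (H_n - H_i), the reversed sum is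
-- C(n+c,n) H_n - E(n,c). Finally Σ_{k=1}^n C(n+m-k, n-k) / k is again such a family in (n,m),
-- with the same values H_n as E at m = 0, so it equals E(n,m).
module Submission where

open import Defs
open import Data.Nat as ℕ using (ℕ; zero; suc; _∸_; _≤_; _<_)
open import Data.Nat.Combinatorics using (_C_; nCk+nC[k+1]≡[n+1]C[k+1]; nCn≡1; nCk≡nC[n∸k])
open import Data.Integer using (+_)
open import Data.Rational using (ℚ; 0ℚ; _+_; _-_; _*_; _/_; fromℚᵘ)
open import Data.Product using (_×_; _,_)
open import Relation.Binary.PropositionalEquality
open ≡-Reasoning

import Data.Nat.Properties as ℕ
import Data.Integer as ℤ
import Data.Integer.Properties as ℤ
import Data.Rational.Properties as ℚ
import Data.Rational.Unnormalised as ℚᵘ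
import Data.Rational.Unnormalised.Properties as ℚᵘ
import Data.Integer.Solver
import Data.Rational.Solver
open import Algebra.Bundles using (CommutativeMonoid)
open import Algebra.Properties.CommutativeSemigroup
  (CommutativeMonoid.commutativeSemigroup ℚ.+-0-commutativeMonoid)
  using (interchange; x∙yz≈xz∙y; xy∙z≈xz∙y)

fromℕ : ℕ → ℚ
fromℕ a = (+ a) / 1

fracᵘ : ℕ → ℕ → ℚᵘ.ℚᵘ
fracᵘ a d = ℚᵘ.mkℚᵘ (+ a) d

frac≡fromℚᵘ : ∀ a d q → fracᵘ a d ℚᵘ.≃ q → frac a d ≡ fromℚᵘ q
frac≡fromℚᵘ a d q = ℚ.fromℚᵘ-cong {fracᵘ a d} {q}

fromℚᵘ-homo-+ : ∀ p q → fromℚᵘ (p ℚᵘ.+ q) ≡ fromℚᵘ p + fromℚᵘ q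
fromℚᵘ-homo-+ p q = ℚ.toℚᵘ-injective (ℚᵘ.≃-trans (ℚ.toℚᵘ-fromℚᵘ _)
  (ℚᵘ.≃-trans (ℚᵘ.+-cong (ℚᵘ.≃-sym (ℚ.toℚᵘ-fromℚᵘ p)) (ℚᵘ.≃-sym (ℚ.toℚᵘ-fromℚᵘ q)))
    (ℚᵘ.≃-sym (ℚ.toℚᵘ-homo-+ (fromℚᵘ p) (fromℚᵘ q)))))

fromℚᵘ-homo-* : ∀ p q → fromℚᵘ (p ℚᵘ.* q) ≡ fromℚᵘ p * fromℚᵘ q
fromℚᵘ-homo-* p q = ℚ.toℚᵘ-injective (ℚᵘ.≃-trans (ℚ.toℚᵘ-fromℚᵘ _)
  (ℚᵘ.≃-trans (ℚᵘ.*-cong (ℚᵘ.≃-sym (ℚ.toℚᵘ-fromℚᵘ p)) (ℚᵘ.≃-sym (ℚ.toℚᵘ-fromℚᵘ q)))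
    (ℚᵘ.≃-sym (ℚ.toℚᵘ-homo-* (fromℚᵘ p) (fromℚᵘ q)))))

fromℕ-+ : ∀ a b → fromℕ (a ℕ.+ b) ≡ fromℕ a + fromℕ b
fromℕ-+ a b = trans (frac≡fromℚᵘ (a ℕ.+ b) 0 (fracᵘ a 0 ℚᵘ.+ fracᵘ b 0) (ℚᵘ.*≡* cross))
                    (fromℚᵘ-homo-+ (fracᵘ a 0) (fracᵘ b 0))
  where
  open Data.Integer.Solver.+-*-Solver
  cross : + (a ℕ.+ b) ℤ.* + 1 ≡ (+ a ℤ.* + 1 ℤ.+ + b ℤ.* + 1) ℤ.* + 1
  cross = trans (cong (ℤ._* + 1) (ℤ.pos-+ a b))
    (solve 2 (λ x y → (x :+ y) :* con (+ 1) := (x :* con (+ 1) :+ y :* con (+ 1)) :* con (+ 1)) refl (+ a) (+ b))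

fromℕ-* : ∀ a b → fromℕ (a ℕ.* b) ≡ fromℕ a * fromℕ b
fromℕ-* a b = trans (frac≡fromℚᵘ (a ℕ.* b) 0 (fracᵘ a 0 ℚᵘ.* fracᵘ b 0) (ℚᵘ.*≡* cross))
                    (fromℚᵘ-homo-* (fracᵘ a 0) (fracᵘ b 0))
  where
  cross : + (a ℕ.* b) ℤ.* + 1 ≡ (+ a ℤ.* + b) ℤ.* + 1
  cross = cong (ℤ._* + 1) (ℤ.pos-* a b)

frac≡fromℕ*frac1 : ∀ a d → frac a d ≡ fromℕ a * frac 1 d
frac≡fromℕ*frac1 a d = trans (frac≡fromℚᵘ a d (fracᵘ a 0 ℚᵘ.* fracᵘ 1 d) (ℚᵘ.*≡* cross))
                             (fromℚᵘ-homo-* (fracᵘ a 0) (fracᵘ 1 d))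
  where
  cross : + a ℤ.* + (1 ℕ.* suc d) ≡ (+ a ℤ.* + 1) ℤ.* + suc d
  cross = cong₂ ℤ._*_ (sym (ℤ.*-identityʳ (+ a))) (cong +_ (ℕ.*-identityˡ (suc d)))

frac-cross : ∀ a d c e → a ℕ.* suc e ≡ c ℕ.* suc d → frac a d ≡ frac c e
frac-cross a d c e eq = frac≡fromℚᵘ a d (fracᵘ c e) (ℚᵘ.*≡* (begin
  + a ℤ.* + suc e  ≡⟨ ℤ.pos-* a (suc e) ⟨
  + (a ℕ.* suc e)  ≡⟨ cong +_ eq ⟩
  + (c ℕ.* suc d)  ≡⟨ ℤ.pos-* c (suc d) ⟩
  + c ℤ.* + suc d  ∎))

frac-+ : ∀ a b d → frac (a ℕ.+ b) d ≡ frac a d + frac b d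
frac-+ a b d = begin
  frac (a ℕ.+ b) d                     ≡⟨ frac≡fromℕ*frac1 (a ℕ.+ b) d ⟩
  fromℕ (a ℕ.+ b) * frac 1 d           ≡⟨ cong (_* frac 1 d) (fromℕ-+ a b) ⟩
  (fromℕ a + fromℕ b) * frac 1 d       ≡⟨ ℚ.*-distribʳ-+ (frac 1 d) (fromℕ a) (fromℕ b) ⟩
  fromℕ a * frac 1 d + fromℕ b * frac 1 d
    ≡⟨ cong₂ _+_ (frac≡fromℕ*frac1 a d) (frac≡fromℕ*frac1 b d) ⟨
  frac a d + frac b d                  ∎

sumBelow-cong : ∀ n {f g : ℕ → ℚ} → (∀ {i} → i < n → f i ≡ g i) → sumBelow n f ≡ sumBelow n g
sumBelow-cong zero    f≡g = refl
sumBelow-cong (suc n) f≡g = cong₂ _+_ (sumBelow-cong n (λ i<n → f≡g (ℕ.m<n⇒m<1+n i<n))) (f≡g (ℕ.n<1+n n))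

sumBelow-+ : ∀ n (f g : ℕ → ℚ) → sumBelow n (λ i → f i + g i) ≡ sumBelow n f + sumBelow n g
sumBelow-+ zero    f g = sym (ℚ.+-identityʳ 0ℚ)
sumBelow-+ (suc n) f g = begin
  sumBelow n (λ i → f i + g i) + (f n + g n)    ≡⟨ cong (_+ (f n + g n)) (sumBelow-+ n f g) ⟩
  (sumBelow n f + sumBelow n g) + (f n + g n)   ≡⟨ interchange (sumBelow n f) (sumBelow n g) (f n) (g n) ⟩
  (sumBelow n f + f n) + (sumBelow n g + g n)   ∎

sumBelow-- : ∀ n (f g : ℕ → ℚ) → sumBelow n (λ i → f i - g i) ≡ sumBelow n f - sumBelow n g
sumBelow-- zero    f g = refl
sumBelow-- (suc n) f g = begin
  sumBelow n (λ i → f i - g i) + (f n - g n)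
    ≡⟨ cong (_+ (f n - g n)) (sumBelow-- n f g) ⟩
  (sumBelow n f - sumBelow n g) + (f n - g n)
    ≡⟨ solve 4 (λ x y u v → (x :- y) :+ (u :- v) := (x :+ u) :- (y :+ v))
         refl (sumBelow n f) (sumBelow n g) (f n) (g n) ⟩
  (sumBelow n f + f n) - (sumBelow n g + g n) ∎
  where open Data.Rational.Solver.+-*-Solver

sumBelow-*ˡ : ∀ n c (f : ℕ → ℚ) → sumBelow n (λ i → c * f i) ≡ c * sumBelow n f
sumBelow-*ˡ zero    c f = sym (ℚ.*-zeroʳ c)
sumBelow-*ˡ (suc n) c f =
  trans (cong (_+ c * f n) (sumBelow-*ˡ n c f)) (sym (ℚ.*-distribˡ-+ c (sumBelow n f) (f n)))

sumBelow-head : ∀ n (f : ℕ → ℚ) → sumBelow (suc n) f ≡ f 0 + sumBelow n (λ i → f (suc i))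
sumBelow-head zero    f = trans (ℚ.+-identityˡ (f 0)) (sym (ℚ.+-identityʳ (f 0)))
sumBelow-head (suc n) f = trans (cong (_+ f (suc n)) (sumBelow-head n f)) (ℚ.+-assoc (f 0) _ _)

sumBelow-reverse : ∀ n (f : ℕ → ℚ) → sumBelow n f ≡ sumBelow n (λ i → f (n ∸ suc i))
sumBelow-reverse zero    f = refl
sumBelow-reverse (suc n) f = begin
  sumBelow n f + f n                              ≡⟨ cong (_+ f n) (sumBelow-reverse n f) ⟩
  sumBelow n (λ i → f (n ∸ suc i)) + f n          ≡⟨ ℚ.+-comm _ (f n) ⟩
  f n + sumBelow n (λ i → f (n ∸ suc i))          ≡⟨ sumBelow-head n (λ i → f (n ∸ i)) ⟨
  sumBelow (suc n) (λ i → f (n ∸ i))              ∎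

B : ℕ → ℕ → ℕ
B zero    r       = 1
B (suc m) zero    = 1
B (suc m) (suc r) = B (suc m) r ℕ.+ B m (suc r)

B-zeroʳ : ∀ m → B m 0 ≡ 1
B-zeroʳ zero    = refl
B-zeroʳ (suc m) = refl

B-comm : ∀ m r → B m r ≡ B r m
B-comm zero    zero    = refl
B-comm zero    (suc r) = refl
B-comm (suc m) zero    = refl
B-comm (suc m) (suc r) =
  trans (cong₂ ℕ._+_ (B-comm (suc m) r) (B-comm m (suc r))) (ℕ.+-comm (B r (suc m)) (B (suc r) m))

C≡B : ∀ m r → (m ℕ.+ r) C m ≡ B m r
C≡B zero    r       = refl
C≡B (suc m) zero    = trans (cong (_C suc m) (ℕ.+-identityʳ (suc m))) (nCn≡1 (suc m))
C≡B (suc m) (suc r) = begin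
  suc (m ℕ.+ suc r) C suc m
    ≡⟨ nCk+nC[k+1]≡[n+1]C[k+1] (m ℕ.+ suc r) m ⟨
  (m ℕ.+ suc r) C m ℕ.+ (m ℕ.+ suc r) C suc m
    ≡⟨ cong (λ x → (m ℕ.+ suc r) C m ℕ.+ x C suc m) (ℕ.+-suc m r) ⟩
  (m ℕ.+ suc r) C m ℕ.+ (suc m ℕ.+ r) C suc m
    ≡⟨ cong₂ ℕ._+_ (C≡B m (suc r)) (C≡B (suc m) r) ⟩
  B m (suc r) ℕ.+ B (suc m) r
    ≡⟨ ℕ.+-comm (B m (suc r)) _ ⟩
  B (suc m) (suc r) ∎

B-diagonal : ∀ {n i} → i ≤ n → B (n ∸ i) i ≡ n C i
B-diagonal {n} {i} i≤n = begin
  B (n ∸ i) i               ≡⟨ C≡B (n ∸ i) i ⟨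
  (n ∸ i ℕ.+ i) C (n ∸ i)   ≡⟨ cong (_C (n ∸ i)) (ℕ.m∸n+n≡m i≤n) ⟩
  n C (n ∸ i)               ≡⟨ nCk≡nC[n∸k] i≤n ⟨
  n C i                     ∎

B-absorb : ∀ m r → B m (suc r) ℕ.* suc r ≡ B m r ℕ.* suc (m ℕ.+ r)
B-absorb zero    r = trans (ℕ.*-identityˡ (suc r)) (sym (ℕ.*-identityˡ (suc r)))
B-absorb (suc m) r = begin
  (B (suc m) r ℕ.+ B m (suc r)) ℕ.* suc r
    ≡⟨ ℕ.*-distribʳ-+ (suc r) (B (suc m) r) _ ⟩
  B (suc m) r ℕ.* suc r ℕ.+ B m (suc r) ℕ.* suc r
    ≡⟨ cong (B (suc m) r ℕ.* suc r ℕ.+_) (B-absorb m r) ⟩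
  B (suc m) r ℕ.* suc r ℕ.+ B m r ℕ.* suc (m ℕ.+ r)
    ≡⟨ cong (B (suc m) r ℕ.* suc r ℕ.+_) swapped ⟨
  B (suc m) r ℕ.* suc r ℕ.+ B (suc m) r ℕ.* suc m
    ≡⟨ ℕ.*-distribˡ-+ (B (suc m) r) (suc r) (suc m) ⟨
  B (suc m) r ℕ.* (suc r ℕ.+ suc m)
    ≡⟨ cong (λ x → B (suc m) r ℕ.* suc x) (ℕ.+-comm r (suc m)) ⟩
  B (suc m) r ℕ.* suc (suc m ℕ.+ r) ∎
  where
  swapped : B (suc m) r ℕ.* suc m ≡ B m r ℕ.* suc (m ℕ.+ r)
  swapped = begin
    B (suc m) r ℕ.* suc m        ≡⟨ cong (ℕ._* suc m) (B-comm (suc m) r) ⟩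
    B r (suc m) ℕ.* suc m        ≡⟨ B-absorb r m ⟩
    B r m ℕ.* suc (r ℕ.+ m)      ≡⟨ cong₂ (λ x y → x ℕ.* suc y) (B-comm r m) (ℕ.+-comm r m) ⟩
    B m r ℕ.* suc (m ℕ.+ r)      ∎

B-pascal-∸ : ∀ {m k} r → k < m → B (m ∸ k) (suc r) ≡ B (m ∸ k) r ℕ.+ B (m ∸ suc k) (suc r)
B-pascal-∸ {m} {k} r k<m =
  subst (λ x → B x (suc r) ≡ B x r ℕ.+ B (m ∸ suc k) (suc r)) (sym (ℕ.+-∸-assoc 1 k<m)) refl

record PascalFamily (G : ℕ → ℕ → ℚ) : Set where
  field
    pascal : ∀ m r → G (suc m) (suc r) ≡ G (suc m) r + G m (suc r)
    edge   : ∀ r → G 0 (suc r) ≡ G 0 r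

  edge-const : ∀ r → G 0 r ≡ G 0 0
  edge-const zero    = refl
  edge-const (suc r) = trans (edge r) (edge-const r)

open PascalFamily

pascalFamily-unique : ∀ {G G′ : ℕ → ℕ → ℚ} → PascalFamily G → PascalFamily G′ →
                      (∀ m → G m 0 ≡ G′ m 0) → ∀ m r → G m r ≡ G′ m r
pascalFamily-unique          P P′ G≡G′ zero    r       =
  trans (edge-const P r) (trans (G≡G′ 0) (sym (edge-const P′ r)))
pascalFamily-unique          P P′ G≡G′ (suc m) zero    = G≡G′ (suc m)
pascalFamily-unique {G} {G′} P P′ G≡G′ (suc m) (suc r) = begin
  G (suc m) (suc r)               ≡⟨ pascal P m r ⟩
  G (suc m) r + G m (suc r)       ≡⟨ cong₂ _+_ (pascalFamily-unique P P′ G≡G′ (suc m) r)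
                                               (pascalFamily-unique P P′ G≡G′ m (suc r)) ⟩
  G′ (suc m) r + G′ m (suc r)     ≡⟨ pascal P′ m r ⟨
  G′ (suc m) (suc r)              ∎

vandermonde : ∀ {G} → PascalFamily G →
              ∀ a n r → sumBelow (suc n) (λ i → fromℕ (a C i) * G (n ∸ i) (r ℕ.+ i)) ≡ G n (r ℕ.+ a)
vandermonde {G} P zero n r = begin
  sumBelow (suc n) (λ i → fromℕ (0 C i) * G (n ∸ i) (r ℕ.+ i))
    ≡⟨ sumBelow-head n _ ⟩
  fromℕ 1 * G n (r ℕ.+ 0) + sumBelow n (λ i → 0ℚ * G (n ∸ suc i) (r ℕ.+ suc i))
    ≡⟨ cong₂ _+_ (ℚ.*-identityˡ (G n (r ℕ.+ 0))) (trans (sumBelow-*ˡ n 0ℚ g) (ℚ.*-zeroˡ (sumBelow n g))) ⟩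
  G n (r ℕ.+ 0) + 0ℚ
    ≡⟨ ℚ.+-identityʳ _ ⟩
  G n (r ℕ.+ 0) ∎
  where
  g : ℕ → ℚ
  g i = G (n ∸ suc i) (r ℕ.+ suc i)
vandermonde {G} P (suc a) zero r = begin
  0ℚ + fromℕ 1 * G 0 (r ℕ.+ 0)   ≡⟨ trans (ℚ.+-identityˡ _) (ℚ.*-identityˡ _) ⟩
  G 0 (r ℕ.+ 0)                   ≡⟨ edge-const P _ ⟩
  G 0 0                           ≡⟨ edge-const P _ ⟨
  G 0 (r ℕ.+ suc a)               ∎
vandermonde {G} P (suc a) (suc n) r = begin
  sumBelow (suc (suc n)) (λ i → fromℕ (suc a C i) * G (suc n ∸ i) (r ℕ.+ i))
    ≡⟨ sumBelow-head (suc n) _ ⟩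
  h + sumBelow (suc n) (λ i → fromℕ (suc a C suc i) * g i)
    ≡⟨ cong (_+_ h) (trans (sumBelow-cong (suc n) (λ {i} _ → split i)) (sumBelow-+ (suc n) _ _)) ⟩
  h + (sumBelow (suc n) (λ i → fromℕ (a C i) * g i) + sumBelow (suc n) (λ i → fromℕ (a C suc i) * g i))
    ≡⟨ x∙yz≈xz∙y h _ _ ⟩
  (h + sumBelow (suc n) (λ i → fromℕ (a C suc i) * g i)) + sumBelow (suc n) (λ i → fromℕ (a C i) * g i)
    ≡⟨ cong₂ _+_ (sumBelow-head (suc n) (λ i → fromℕ (a C i) * G (suc n ∸ i) (r ℕ.+ i)))
                 (sumBelow-cong (suc n) (λ {i} _ → cong (λ x → fromℕ (a C i) * G (n ∸ i) x)
                                                         (sym (ℕ.+-suc r i)))) ⟨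
  sumBelow (suc (suc n)) (λ i → fromℕ (a C i) * G (suc n ∸ i) (r ℕ.+ i))
    + sumBelow (suc n) (λ i → fromℕ (a C i) * G (n ∸ i) (suc r ℕ.+ i))
    ≡⟨ cong₂ _+_ (vandermonde P a (suc n) r) (vandermonde P a n (suc r)) ⟩
  G (suc n) (r ℕ.+ a) + G n (suc r ℕ.+ a)
    ≡⟨ pascal P n (r ℕ.+ a) ⟨
  G (suc n) (suc (r ℕ.+ a))
    ≡⟨ cong (G (suc n)) (ℕ.+-suc r a) ⟨
  G (suc n) (r ℕ.+ suc a) ∎
  where
  h : ℚ
  h = fromℕ 1 * G (suc n) (r ℕ.+ 0)
  g : ℕ → ℚ
  g i = G (n ∸ i) (r ℕ.+ suc i)
  split : ∀ i → fromℕ (suc a C suc i) * g i ≡ fromℕ (a C i) * g i + fromℕ (a C suc i) * g i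
  split i = begin
    fromℕ (suc a C suc i) * g i
      ≡⟨ cong (λ x → fromℕ x * g i) (nCk+nC[k+1]≡[n+1]C[k+1] a i) ⟨
    fromℕ (a C i ℕ.+ a C suc i) * g i
      ≡⟨ cong (_* g i) (fromℕ-+ (a C i) (a C suc i)) ⟩
    (fromℕ (a C i) + fromℕ (a C suc i)) * g i
      ≡⟨ ℚ.*-distribʳ-+ (g i) (fromℕ (a C i)) (fromℕ (a C suc i)) ⟩
    fromℕ (a C i) * g i + fromℕ (a C suc i) * g i ∎

B-pascalFamily : PascalFamily (λ m r → fromℕ (B m r))
B-pascalFamily = record
  { pascal = λ m r → fromℕ-+ (B (suc m) r) (B m (suc r))
  ; edge   = λ r → refl
  }

E : ℕ → ℕ → ℚ
E m r = fromℕ (B m r) * (H (m ℕ.+ r) - H r)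

E-zeroˡ : ∀ r → E 0 r ≡ 0ℚ
E-zeroˡ r = trans (cong (fromℕ 1 *_) (ℚ.+-inverseʳ (H r))) (ℚ.*-zeroʳ (fromℕ 1))

E-zeroʳ : ∀ m → E m 0 ≡ H m
E-zeroʳ m = begin
  fromℕ (B m 0) * (H (m ℕ.+ 0) - 0ℚ)  ≡⟨ cong₂ (λ b x → fromℕ b * (H x - 0ℚ)) (B-zeroʳ m) (ℕ.+-identityʳ m) ⟩
  fromℕ 1 * (H m - 0ℚ)                ≡⟨ trans (ℚ.*-identityˡ _) (ℚ.+-identityʳ (H m)) ⟩
  H m                                 ∎

E-diagonal : ∀ {n i} → i ≤ n → E (n ∸ i) i ≡ fromℕ (n C i) * (H n - H i)
E-diagonal {n} {i} i≤n = cong₂ (λ b x → fromℕ b * (H x - H i)) (B-diagonal i≤n) (ℕ.m∸n+n≡m i≤n)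

-- The harmonic increments 1/(m+r+2) and 1/(r+1) balance by the absorption identity B-absorb.
E-pascalFamily : PascalFamily E
E-pascalFamily = record
  { pascal = pascal-E
  ; edge   = λ r → trans (E-zeroˡ (suc r)) (sym (E-zeroˡ r))
  }
  where
  open Data.Rational.Solver.+-*-Solver
  pascal-E : ∀ m r → E (suc m) (suc r) ≡ E (suc m) r + E m (suc r)
  pascal-E m r = begin
    fromℕ (B (suc m) r ℕ.+ B m (suc r)) * (H (suc (m ℕ.+ suc r)) - H (suc r))
      ≡⟨ cong₂ (λ b x → b * (H (suc x) - H (suc r))) (fromℕ-+ (B (suc m) r) (B m (suc r)))
               (ℕ.+-suc m r) ⟩
    (b₁ + b₂) * ((X + f₁) - (H r + f₂))
      ≡⟨ solve 6 (λ b₁ b₂ X f₁ h f₂ → (b₁ :+ b₂) :* ((X :+ f₁) :- (h :+ f₂))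
                                    := (b₁ :+ b₂) :* (X :- (h :+ f₂)) :+ (b₁ :+ b₂) :* f₁)
                 refl b₁ b₂ X f₁ (H r) f₂ ⟩
    (b₁ + b₂) * (X - (H r + f₂)) + (b₁ + b₂) * f₁
      ≡⟨ cong (_+_ ((b₁ + b₂) * (X - (H r + f₂)))) absorb ⟩
    (b₁ + b₂) * (X - (H r + f₂)) + b₁ * f₂
      ≡⟨ solve 5 (λ b₁ b₂ X h f₂ → (b₁ :+ b₂) :* (X :- (h :+ f₂)) :+ b₁ :* f₂
                                  := b₁ :* (X :- h) :+ b₂ :* (X :- (h :+ f₂)))
                 refl b₁ b₂ X (H r) f₂ ⟩
    b₁ * (X - H r) + b₂ * (X - H (suc r))
      ≡⟨ cong (λ x → b₁ * (X - H r) + b₂ * (H x - H (suc r))) (ℕ.+-suc m r) ⟨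
    E (suc m) r + E m (suc r) ∎
    where
    b₁ b₂ X f₁ f₂ : ℚ
    b₁ = fromℕ (B (suc m) r)
    b₂ = fromℕ (B m (suc r))
    X  = H (suc (m ℕ.+ r))
    f₁ = frac 1 (suc (m ℕ.+ r))
    f₂ = frac 1 r
    absorb : (b₁ + b₂) * f₁ ≡ b₁ * f₂
    absorb = begin
      (b₁ + b₂) * f₁
        ≡⟨ cong (_* f₁) (fromℕ-+ (B (suc m) r) (B m (suc r))) ⟨
      fromℕ (B (suc m) (suc r)) * f₁
        ≡⟨ frac≡fromℕ*frac1 (B (suc m) (suc r)) (suc (m ℕ.+ r)) ⟨
      frac (B (suc m) (suc r)) (suc (m ℕ.+ r))
        ≡⟨ frac-cross (B (suc m) (suc r)) (suc (m ℕ.+ r)) (B (suc m) r) r (B-absorb (suc m) r) ⟩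
      frac (B (suc m) r) r
        ≡⟨ frac≡fromℕ*frac1 (B (suc m) r) r ⟩
      b₁ * f₂ ∎

F : ℕ → ℕ → ℚ
F m r = sumBelow m (λ k → frac (B (m ∸ suc k) r) k)

F-pascalFamily : PascalFamily F
F-pascalFamily = record
  { pascal = pascal-F
  ; edge   = λ r → refl
  }
  where
  pascal-F : ∀ m r → F (suc m) (suc r) ≡ F (suc m) r + F m (suc r)
  pascal-F m r = begin
    sumBelow m (λ k → frac (B (m ∸ k) (suc r)) k) + frac (B (m ∸ m) (suc r)) m
      ≡⟨ cong₂ _+_ (trans (sumBelow-cong m split) (sumBelow-+ m _ _)) last ⟩
    (sumBelow m (λ k → frac (B (m ∸ k) r) k) + F m (suc r)) + frac (B (m ∸ m) r) m
      ≡⟨ xy∙z≈xz∙y (sumBelow m (λ k → frac (B (m ∸ k) r) k)) (F m (suc r)) (frac (B (m ∸ m) r) m) ⟩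
    F (suc m) r + F m (suc r) ∎
    where
    split : ∀ {k} → k < m →
            frac (B (m ∸ k) (suc r)) k ≡ frac (B (m ∸ k) r) k + frac (B (m ∸ suc k) (suc r)) k
    split {k} k<m = trans (cong (λ b → frac b k) (B-pascal-∸ r k<m)) (frac-+ (B (m ∸ k) r) _ k)
    last : frac (B (m ∸ m) (suc r)) m ≡ frac (B (m ∸ m) r) m
    last = trans (cong (λ x → frac (B x (suc r)) m) (ℕ.n∸n≡0 m))
                 (cong (λ x → frac (B x r) m) (sym (ℕ.n∸n≡0 m)))

F≡E : ∀ m r → F m r ≡ E m r
F≡E = pascalFamily-unique F-pascalFamily E-pascalFamily F≡E-zeroʳ
  where
  F≡E-zeroʳ : ∀ m → F m 0 ≡ E m 0
  F≡E-zeroʳ m = trans (sumBelow-cong m (λ {k} _ → cong (λ b → frac b k) (B-zeroʳ (m ∸ suc k))))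
                      (sym (E-zeroʳ m))

tail-sum≡F : ∀ n m → sum1to n (λ k → frac (((n ℕ.+ m) ∸ k) C (n ∸ k)) (k ∸ 1)) ≡ F n m
tail-sum≡F n m = sumBelow-cong n (λ {k} k<n →
  cong (λ c → frac c k) (trans (cong (_C (n ∸ suc k)) (ℕ.+-∸-comm m k<n)) (C≡B (n ∸ suc k) m)))

harmonic-convolution : ∀ (a : ℕ → ℕ) N →
  sum1to N (λ k → sumBelow k (λ j → frac (a j) (k ∸ j ∸ 1)))
    ≡ sumBelow (suc N) (λ j → fromℕ (a j) * H (N ∸ j))
harmonic-convolution a zero    = sym (trans (ℚ.+-identityˡ _) (ℚ.*-zeroʳ (fromℕ (a 0))))
harmonic-convolution a (suc N) = begin
  sum1to N (λ k → sumBelow k (λ j → frac (a j) (k ∸ j ∸ 1)))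
    + sumBelow (suc N) (λ j → frac (a j) (suc N ∸ j ∸ 1))
    ≡⟨ cong₂ _+_ (harmonic-convolution a N)
                 (sumBelow-cong (suc N) (λ {j} j<1+N → cong (λ d → frac (a j) (d ∸ 1)) (1+N∸j j<1+N))) ⟩
  sumBelow (suc N) (λ j → fromℕ (a j) * H (N ∸ j)) + sumBelow (suc N) (λ j → frac (a j) (N ∸ j))
    ≡⟨ sumBelow-+ (suc N) _ _ ⟨
  sumBelow (suc N) (λ j → fromℕ (a j) * H (N ∸ j) + frac (a j) (N ∸ j))
    ≡⟨ sumBelow-cong (suc N) extend ⟩
  sumBelow (suc N) (λ j → fromℕ (a j) * H (suc N ∸ j))
    ≡⟨ ℚ.+-identityʳ _ ⟨
  sumBelow (suc N) (λ j → fromℕ (a j) * H (suc N ∸ j)) + 0ℚ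
    ≡⟨ cong (_+_ (sumBelow (suc N) (λ j → fromℕ (a j) * H (suc N ∸ j))))
            (trans (cong (λ x → fromℕ (a (suc N)) * H x) (ℕ.n∸n≡0 N)) (ℚ.*-zeroʳ (fromℕ (a (suc N))))) ⟨
  sumBelow (suc (suc N)) (λ j → fromℕ (a j) * H (suc N ∸ j)) ∎
  where
  1+N∸j : ∀ {j} → j < suc N → suc N ∸ j ≡ suc (N ∸ j)
  1+N∸j j<1+N = ℕ.+-∸-assoc 1 (ℕ.≤-pred j<1+N)
  extend : ∀ {j} → j < suc N →
           fromℕ (a j) * H (N ∸ j) + frac (a j) (N ∸ j) ≡ fromℕ (a j) * H (suc N ∸ j)
  extend {j} j<1+N = begin
    fromℕ (a j) * H (N ∸ j) + frac (a j) (N ∸ j)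
      ≡⟨ cong (_+_ (fromℕ (a j) * H (N ∸ j))) (frac≡fromℕ*frac1 (a j) (N ∸ j)) ⟩
    fromℕ (a j) * H (N ∸ j) + fromℕ (a j) * frac 1 (N ∸ j)
      ≡⟨ ℚ.*-distribˡ-+ (fromℕ (a j)) _ _ ⟨
    fromℕ (a j) * H (suc (N ∸ j))
      ≡⟨ cong (λ x → fromℕ (a j) * H x) (1+N∸j j<1+N) ⟨
    fromℕ (a j) * H (suc N ∸ j) ∎

binomial-harmonic-sum : ∀ n c →
  sumBelow (suc n) (λ i → fromℕ ((n C i) ℕ.* (c C i)) * H i) ≡ H n * fromℕ (B n c) - E n c
binomial-harmonic-sum n c = begin
  sumBelow (suc n) (λ i → fromℕ ((n C i) ℕ.* (c C i)) * H i)
    ≡⟨ sumBelow-cong (suc n) (λ i<1+n → split (ℕ.≤-pred i<1+n)) ⟩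
  sumBelow (suc n) (λ i → H n * (γ i * β i) - γ i * E (n ∸ i) i)
    ≡⟨ sumBelow-- (suc n) _ _ ⟩
  sumBelow (suc n) (λ i → H n * (γ i * β i)) - sumBelow (suc n) (λ i → γ i * E (n ∸ i) i)
    ≡⟨ cong₂ _-_ (sumBelow-*ˡ (suc n) (H n) _) (vandermonde E-pascalFamily c n 0) ⟩
  H n * sumBelow (suc n) (λ i → γ i * β i) - E n c
    ≡⟨ cong (λ x → H n * x - E n c) (vandermonde B-pascalFamily c n 0) ⟩
  H n * fromℕ (B n c) - E n c ∎
  where
  open Data.Rational.Solver.+-*-Solver
  γ β : ℕ → ℚ
  γ i = fromℕ (c C i)
  β i = fromℕ (B (n ∸ i) i)
  split : ∀ {i} → i ≤ n → fromℕ ((n C i) ℕ.* (c C i)) * H i ≡ H n * (γ i * β i) - γ i * E (n ∸ i) i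
  split {i} i≤n = begin
    fromℕ ((n C i) ℕ.* (c C i)) * H i
      ≡⟨ cong (_* H i) (fromℕ-* (n C i) (c C i)) ⟩
    (ν * γ i) * H i
      ≡⟨ solve 4 (λ ν γ h hᵢ → (ν :* γ) :* hᵢ := h :* (γ :* ν) :- γ :* (ν :* (h :- hᵢ)))
           refl ν (γ i) (H n) (H i) ⟩
    H n * (γ i * ν) - γ i * (ν * (H n - H i))
      ≡⟨ cong₂ (λ b e → H n * (γ i * fromℕ b) - γ i * e) (B-diagonal i≤n) (E-diagonal i≤n) ⟨
    H n * (γ i * β i) - γ i * E (n ∸ i) i ∎
    where
    ν : ℚ
    ν = fromℕ (n C i)

binomial-double-sum : ∀ n c (a : ℕ → ℕ) → (∀ {i} → i ≤ n → a (n ∸ i) ≡ (n C i) ℕ.* (c C i)) →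
  sum1to n (λ k → sumBelow k (λ j → frac (a j) (k ∸ j ∸ 1))) ≡ H n * fromℕ (B n c) - E n c
binomial-double-sum n c a a-reversed = begin
  sum1to n (λ k → sumBelow k (λ j → frac (a j) (k ∸ j ∸ 1)))
    ≡⟨ harmonic-convolution a n ⟩
  sumBelow (suc n) (λ j → fromℕ (a j) * H (n ∸ j))
    ≡⟨ sumBelow-reverse (suc n) _ ⟩
  sumBelow (suc n) (λ i → fromℕ (a (n ∸ i)) * H (n ∸ (n ∸ i)))
    ≡⟨ sumBelow-cong (suc n) (λ i<1+n → reindex (ℕ.≤-pred i<1+n)) ⟩
  sumBelow (suc n) (λ i → fromℕ ((n C i) ℕ.* (c C i)) * H i)
    ≡⟨ binomial-harmonic-sum n c ⟩
  H n * fromℕ (B n c) - E n c ∎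
  where
  reindex : ∀ {i} → i ≤ n → fromℕ (a (n ∸ i)) * H (n ∸ (n ∸ i)) ≡ fromℕ ((n C i) ℕ.* (c C i)) * H i
  reindex i≤n = cong₂ (λ x y → fromℕ x * H y) (a-reversed i≤n) (ℕ.m∸[m∸n]≡n i≤n)

2*n≡n+n : ∀ n → 2 ℕ.* n ≡ n ℕ.+ n
2*n≡n+n n = cong (n ℕ.+_) (ℕ.+-identityʳ n)

C[2n]-mirror : ∀ {n i} → i ≤ n → (2 ℕ.* n) C (n ℕ.+ (n ∸ i)) ≡ (2 ℕ.* n) C i
C[2n]-mirror {n} {i} i≤n = begin
  (2 ℕ.* n) C (n ℕ.+ (n ∸ i))   ≡⟨ cong ((2 ℕ.* n) C_) (ℕ.+-∸-assoc n i≤n) ⟨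
  (2 ℕ.* n) C ((n ℕ.+ n) ∸ i)   ≡⟨ cong (λ m → (2 ℕ.* n) C (m ∸ i)) (2*n≡n+n n) ⟨
  (2 ℕ.* n) C (2 ℕ.* n ∸ i)     ≡⟨ nCk≡nC[n∸k] (ℕ.≤-trans i≤n (ℕ.m≤m+n n _)) ⟨
  (2 ℕ.* n) C i                 ∎

double-sum-of-squares : ∀ n →
  sum1to n (λ k → sumBelow k (λ j → frac ((n C j) ℕ.* (n C j)) (k ∸ j ∸ 1)))
    ≡ fromℕ ((2 ℕ.* n) C n) * ((H n + H n) - H (2 ℕ.* n))
double-sum-of-squares n = begin
  sum1to n (λ k → sumBelow k (λ j → frac ((n C j) ℕ.* (n C j)) (k ∸ j ∸ 1)))
    ≡⟨ binomial-double-sum n n (λ j → (n C j) ℕ.* (n C j))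
         (λ i≤n → cong (λ x → x ℕ.* x) (sym (nCk≡nC[n∸k] i≤n))) ⟩
  H n * fromℕ (B n n) - fromℕ (B n n) * (H (n ℕ.+ n) - H n)
    ≡⟨ solve 3 (λ h b h₂ → h :* b :- b :* (h₂ :- h) := b :* ((h :+ h) :- h₂))
         refl (H n) (fromℕ (B n n)) (H (n ℕ.+ n)) ⟩
  fromℕ (B n n) * ((H n + H n) - H (n ℕ.+ n))
    ≡⟨ cong (λ b → fromℕ b * ((H n + H n) - H (n ℕ.+ n))) (C≡B n n) ⟨
  fromℕ ((n ℕ.+ n) C n) * ((H n + H n) - H (n ℕ.+ n))
    ≡⟨ cong (λ m → fromℕ (m C n) * ((H n + H n) - H m)) (2*n≡n+n n) ⟨
  fromℕ ((2 ℕ.* n) C n) * ((H n + H n) - H (2 ℕ.* n)) ∎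
  where open Data.Rational.Solver.+-*-Solver

double-sum-of-products : ∀ n →
  sum1to n (λ k → sumBelow k (λ j → frac ((n C j) ℕ.* ((2 ℕ.* n) C (n ℕ.+ j))) (k ∸ j ∸ 1)))
    ≡ fromℕ ((3 ℕ.* n) C n) * H n - sum1to n (λ k → frac (((3 ℕ.* n) ∸ k) C (n ∸ k)) (k ∸ 1))
double-sum-of-products n = begin
  sum1to n (λ k → sumBelow k (λ j → frac ((n C j) ℕ.* ((2 ℕ.* n) C (n ℕ.+ j))) (k ∸ j ∸ 1)))
    ≡⟨ binomial-double-sum n (2 ℕ.* n) (λ j → (n C j) ℕ.* ((2 ℕ.* n) C (n ℕ.+ j)))
         (λ i≤n → cong₂ ℕ._*_ (sym (nCk≡nC[n∸k] i≤n)) (C[2n]-mirror i≤n)) ⟩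
  H n * fromℕ (B n (2 ℕ.* n)) - E n (2 ℕ.* n)
    ≡⟨ cong₂ (λ b e → H n * fromℕ b - e) (C≡B n (2 ℕ.* n))
             (trans (tail-sum≡F n (2 ℕ.* n)) (F≡E n (2 ℕ.* n))) ⟨
  H n * fromℕ ((3 ℕ.* n) C n) - tail
    ≡⟨ cong (_- tail) (ℚ.*-comm (H n) (fromℕ ((3 ℕ.* n) C n))) ⟩
  fromℕ ((3 ℕ.* n) C n) * H n - tail ∎
  where
  tail : ℚ
  tail = sum1to n (λ k → frac (((3 ℕ.* n) ∸ k) C (n ∸ k)) (k ∸ 1))

proposition17 : (n : ℕ) →
    (sum1to n (λ k → sumBelow k (λ j → frac ((n C j) ℕ.* (n C j)) (k ∸ j ∸ 1)))
      ≡ ((+ ((2 ℕ.* n) C n)) / 1) * ((H n + H n) - H (2 ℕ.* n)))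
    ×
    (sum1to n (λ k → sumBelow k (λ j → frac ((n C j) ℕ.* ((2 ℕ.* n) C (n ℕ.+ j))) (k ∸ j ∸ 1)))
      ≡ ((+ ((3 ℕ.* n) C n)) / 1) * H n
        - sum1to n (λ k → frac (((3 ℕ.* n) ∸ k) C (n ∸ k)) (k ∸ 1)))
proposition17 n = double-sum-of-squares n , double-sum-of-products n
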